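{- Let $M\ge 0$ be an integer and consider an $M$-degree-bounded locality-aware healing algorithm used on a network that is a tree. If a node $v$ with degree at least $M+3$ is deleted, then at least two neighbors of $v$ have their degree increased (compared with their degree before the deletion).
   Context: A healing algorithm is locality-aware if, after the deletion of a node $v$, it adds new edges only between pairs of former neighbors of $v$, reconnecting these neighbors so the network stays connected. It is $M$-degree-bounded if in any single round (one deletion followed by healing) any node increases its degree by at most $M$. Degree changes are net: each neighbor of $v$ loses its edge to $v$ and gains its incident healing edges. -}

module Defs where

open import Data.Nat using (ℕ; _≤_; _+_)
open import Data.Bool using (Bool; true; false; T)
open import Data.Fin using (Fin)
open import Data.List using (List; []; _∷_; _++_; [_]; length; filterᵇ; allFin)
open import Data.List.Relation.Unary.Linked using (Linked)
open import Data.List.Relation.Unary.Unique.Propositional using (Unique)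
open import Data.Product using (_×_)
open import Data.Sum using (_⊎_)
open import Relation.Nullary using (¬_)
open import Relation.Binary.PropositionalEquality using (_≡_; _≢_)

record Graph (n : ℕ) : Set where
  field
    adj     : Fin n → Fin n → Bool
    adj-sym : ∀ x y → adj x y ≡ adj y x
    adj-irr : ∀ x → adj x x ≡ false
open Graph public

Adj : ∀ {n} → Graph n → Fin n → Fin n → Set
Adj G x y = T (adj G x y)

deg : ∀ {n} → Graph n → Fin n → ℕ
deg {n} G x = length (filterᵇ (adj G x) (allFin n))

data Reachable {n} (G : Graph n) : Fin n → Fin n → Set where
  here  : ∀ {x} → Reachable G x x
  step  : ∀ {x y z} → Adj G x y → Reachable G y z → Reachable G x z

Connected : ∀ {n} → Graph n → Set
Connected G = ∀ x y → Reachable G x y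

record Cycle {n} (G : Graph n) : Set where
  field
    start  : Fin n
    rest   : List (Fin n)
    long   : 2 ≤ length rest
    unique : Unique (start ∷ rest)
    closed : Linked (Adj G) (start ∷ rest ++ [ start ])

Acyclic : ∀ {n} → Graph n → Set
Acyclic G = ¬ Cycle G

IsTree : ∀ {n} → Graph n → Set
IsTree G = Connected G × Acyclic G

-- One round of a locality-aware healing algorithm: node v is deleted from G
-- and H is the resulting healed network (on the same vertex set; v is
-- isolated in H, i.e. it is no longer present).
record LocalityAwareHealing {n} (G : Graph n) (v : Fin n) (H : Graph n) : Set where
  field
    deleted   : ∀ x → adj H v x ≡ false
    keeps     : ∀ x y → x ≢ v → y ≢ v → Adj G x y → Adj H x y
    local     : ∀ x y → Adj H x y → Adj G x y ⊎ (Adj G v x × Adj G v y)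
    connected : ∀ x y → x ≢ v → y ≢ v → Reachable H x y

DegreeBounded : ∀ {n} → ℕ → Graph n → Fin n → Graph n → Set
DegreeBounded M G v H = ∀ x → x ≢ v → deg H x ≤ deg G x + M

-- Let N be the set of neighbours of v. As G has no triangles, a vertex a ∈ N has no
-- G-edge into N, so in H it loses its edge to v and gains exactly its healing edges into N:
-- its degree grows iff it has at least two of them, and degree-boundedness allows at most
-- M + 1. Every component of G − v contains exactly one vertex of N, so connectivity of H
-- forces the healing edges to connect N. Given any c ∈ N, since |N| ≥ M + 3 some u ∈ N − c
-- is not healed to c; if no vertex of N other than c had two healing edges, the healing
-- neighbours of u would all be leaves, so the healing component of u would be the star
-- around u and would miss c. Applying this twice yields two vertices whose degree grows.

module Submission where

open import Defs
open import Data.Nat using (ℕ; suc; _+_; _≤_; _<_; z≤n; s≤s; _≤?_)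
open import Data.Nat.Properties
  using (≤-reflexive; ≤-trans; n≤1+n; +-mono-≤; +-monoˡ-≤; +-monoʳ-≤; +-cancelˡ-≤; +-cancelʳ-≤;
         +-suc; +-comm; m≤n+m; ≮⇒≥; n≮n; module ≤-Reasoning)
open import Data.Bool using (T)
open import Data.Fin using (Fin; _≟_)
open import Data.Fin.Properties using (any?)
open import Data.List using (List; []; _∷_; _++_; [_]; length; filter; allFin; last)
open import Data.List.Properties using (filter-some; filter-none)
open import Data.List.Membership.Propositional using (_∈_; lose)
open import Data.List.Membership.Propositional.Properties using (∈-allFin)
open import Data.List.Relation.Unary.All as All using (All; []; _∷_)
open import Data.List.Relation.Unary.All.Properties.Core using (¬Any⇒All¬)
open import Data.List.Relation.Unary.Any using (here; there)
open import Data.List.Relation.Unary.AllPairs as AllPairs using ([]; _∷_)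
open import Data.List.Relation.Unary.Linked as Linked using (Linked; [-]; _∷_)
open import Data.List.Relation.Unary.Unique.Propositional using (Unique)
open import Data.List.Relation.Unary.Unique.Propositional.Properties using (allFin⁺)
open import Data.Maybe using (just)
open import Data.Maybe.Properties using (just-injective)
open import Data.Product using (Σ; ∃; _×_; _,_; proj₂; swap)
open import Data.Sum using (_⊎_; inj₁; inj₂; [_,_]′)
open import Function using (_∘_)
open import Data.Empty using (⊥; ⊥-elim)
open import Relation.Nullary using (¬_; yes; no; ¬?)
open import Relation.Nullary.Decidable using (T?; _×-dec_; decidable-stable)
open import Relation.Unary using (Decidable)
open import Relation.Unary.Properties using (_∩?_; ∁?)
open import Relation.Binary using (DecidableEquality)
open import Relation.Binary.PropositionalEquality using (_≡_; _≢_; ≢-sym; refl; sym; trans; cong; subst)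

module _ {A : Set} where

  count : {P : A → Set} → Decidable P → List A → ℕ
  count P? xs = length (filter P? xs)

  module _ {P : A → Set} (P? : Decidable P) where

    count-mono : {Q : A → Set} (Q? : Decidable Q) → (∀ {x} → P x → Q x) →
                 ∀ xs → count P? xs ≤ count Q? xs
    count-mono Q? P⊆Q [] = z≤n
    count-mono Q? P⊆Q (x ∷ xs) with P? x | Q? x
    ... | yes _  | yes _  = s≤s (count-mono Q? P⊆Q xs)
    ... | yes px | no ¬qx = ⊥-elim (¬qx (P⊆Q px))
    ... | no _   | yes _  = ≤-trans (count-mono Q? P⊆Q xs) (n≤1+n _)
    ... | no _   | no _   = count-mono Q? P⊆Q xs

    count-split : {Q : A → Set} (Q? : Decidable Q) →
                  ∀ xs → count P? xs ≡ count (P? ∩? Q?) xs + count (P? ∩? ∁? Q?) xs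
    count-split Q? [] = refl
    count-split Q? (x ∷ xs) with P? x | Q? x
    ... | yes _ | yes _ = cong suc (count-split Q? xs)
    ... | yes _ | no _  = trans (cong suc (count-split Q? xs)) (sym (+-suc _ _))
    ... | no _  | _     = count-split Q? xs

    count-witness : ∀ xs → 1 ≤ count P? xs → ∃ P
    count-witness (x ∷ xs) pos with P? x
    ... | yes px = x , px
    ... | no _   = count-witness xs pos

    count-member : ∀ {x xs} → x ∈ xs → P x → 1 ≤ count P? xs
    count-member x∈xs px = filter-some P? (lose x∈xs px)

  module _ (_≟_ : DecidableEquality A) where

    count-≡-unique : ∀ {a xs} → Unique xs → count (_≟ a) xs ≤ 1
    count-≡-unique {a} {[]} _ = z≤n
    count-≡-unique {a} {x ∷ xs} (x∉xs ∷ xs-unique) with x ≟ a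
    ... | yes refl = s≤s (≤-reflexive (cong length (filter-none (_≟ a) (All.map ≢-sym x∉xs))))
    ... | no _     = count-≡-unique xs-unique

    module _ {P : A → Set} (P? : Decidable P) where

      count-witness-≢ : ∀ {xs} → Unique xs → 2 ≤ count P? xs → ∀ a → ∃ λ b → P b × b ≢ a
      count-witness-≢ {xs} xs-unique two a = count-witness (P? ∩? ∁? (_≟ a)) xs (+-cancelˡ-≤ 1 _ _ (begin
        2                                                   ≤⟨ two ⟩
        count P? xs                                         ≡⟨ count-split P? (_≟ a) xs ⟩
        count (P? ∩? (_≟ a)) xs + count (P? ∩? ∁? (_≟ a)) xs
          ≤⟨ +-monoˡ-≤ _ (≤-trans (count-mono (P? ∩? (_≟ a)) (_≟ a) proj₂ xs) (count-≡-unique xs-unique)) ⟩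
        1 + count (P? ∩? ∁? (_≟ a)) xs                      ∎))
        where open ≤-Reasoning

      count-two : ∀ {x y xs} → x ∈ xs → y ∈ xs → x ≢ y → P x → P y → 2 ≤ count P? xs
      count-two {x} {xs = xs} x∈xs y∈xs x≢y px py =
        subst (2 ≤_) (sym (count-split P? (_≟ x) xs))
          (+-mono-≤ (count-member (P? ∩? (_≟ x)) x∈xs (px , refl))
                    (count-member (P? ∩? ∁? (_≟ x)) y∈xs (py , ≢-sym x≢y)))

module _ {n : ℕ} where

  Adj? : (K : Graph n) → ∀ x → Decidable (Adj K x)
  Adj? K x y = T? (adj K x y)

  Adj-sym : ∀ (K : Graph n) {x y} → Adj K x y → Adj K y x
  Adj-sym K {x} {y} = subst T (adj-sym K x y)

  Adj⇒≢ : ∀ (K : Graph n) {x y} → Adj K x y → x ≢ y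
  Adj⇒≢ K {x} Kxx refl = subst T (adj-irr K x) Kxx

  Reachable-closed : ∀ {K : Graph n} {P : Fin n → Set} → (∀ {x y} → P x → Adj K x y → P y) →
                     ∀ {x y} → P x → Reachable K x y → P y
  Reachable-closed closed px here           = px
  Reachable-closed closed px (step Kxy rxy) = Reachable-closed closed (closed px Kxy) rxy

  triangle-free : ∀ {G : Graph n} → Acyclic G → ∀ {x y z} → Adj G x y → Adj G y z → Adj G z x → ⊥
  triangle-free {G} acyclic Gxy Gyz Gzx = acyclic record
    { start  = _
    ; rest   = _ ∷ _ ∷ []
    ; long   = s≤s (s≤s z≤n)
    ; unique = (Adj⇒≢ G Gxy ∷ Adj⇒≢ G (Adj-sym G Gzx) ∷ []) ∷ (Adj⇒≢ G Gyz ∷ []) ∷ [] ∷ []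
    ; closed = Gxy ∷ Gyz ∷ Gzx ∷ [-]
    }

  data ReachableWithout (G : Graph n) (v w : Fin n) : Fin n → Set where
    start  : w ≢ v → ReachableWithout G v w w
    extend : ∀ {y z} → ReachableWithout G v w y → Adj G y z → z ≢ v → ReachableWithout G v w z

  module LoopErasure (G : Graph n) (v w : Fin n) where

    open import Data.List.Membership.DecPropositional (_≟_ {n}) using (_∈?_)

    -- ps ++ [ v ] is a simple path, ps listed from its current end back to w.
    record PathToV (ps : List (Fin n)) : Set where
      field
        ends-at-w : last ps ≡ just w
        avoids-v  : All (v ≢_) ps
        distinct  : Unique ps
        linked    : Linked (Adj G) (ps ++ [ v ])
    open PathToV public

    suffix : ∀ {z ps} → z ∈ ps → PathToV ps → ∃ λ zs → PathToV (z ∷ zs)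
    suffix {ps = _ ∷ zs}    (here refl)  p = zs , p
    suffix {ps = _ ∷ _ ∷ _} (there z∈ps) p = suffix z∈ps record
      { ends-at-w = ends-at-w p
      ; avoids-v  = All.tail (avoids-v p)
      ; distinct  = AllPairs.tail (distinct p)
      ; linked    = Linked.tail (linked p)
      }

    erase : Adj G v w → ∀ {x} → ReachableWithout G v w x → ∃ λ zs → PathToV (x ∷ zs)
    erase Gvw (start w≢v) = [] , record
      { ends-at-w = refl
      ; avoids-v  = ≢-sym w≢v ∷ []
      ; distinct  = [] ∷ []
      ; linked    = Adj-sym G Gvw ∷ [-]
      }
    erase Gvw (extend {y} {z} r Gyz z≢v) with erase Gvw r
    ... | zs , p with z ∈? (y ∷ zs)
    ...   | yes z∈ps = suffix z∈ps p
    ...   | no z∉ps  = y ∷ zs , record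
      { ends-at-w = ends-at-w p
      ; avoids-v  = ≢-sym z≢v ∷ avoids-v p
      ; distinct  = ¬Any⇒All¬ _ z∉ps ∷ distinct p
      ; linked    = Adj-sym G Gyz ∷ linked p
      }

  acyclic⇒separated : ∀ {G : Graph n} → Acyclic G → ∀ {v w x} → Adj G v w → Adj G v x →
                      ReachableWithout G v w x → x ≡ w
  acyclic⇒separated {G} acyclic {v} {w} {x} Gvw Gvx r with LoopErasure.erase G v w Gvw r
  ... | []     , p = just-injective (LoopErasure.ends-at-w p)
  ... | z ∷ zs , p = ⊥-elim (acyclic record
    { start  = v
    ; rest   = x ∷ z ∷ zs
    ; long   = s≤s (s≤s z≤n)
    ; unique = LoopErasure.avoids-v p ∷ LoopErasure.distinct p
    ; closed = Gvx ∷ LoopErasure.linked p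
    })

module Healing {n} {G H : Graph n} {v : Fin n}
               (acyclic : Acyclic G) (heal : LocalityAwareHealing G v H) where

  open LocalityAwareHealing heal

  healDeg : Fin n → ℕ
  healDeg a = count (Adj? H a ∩? Adj? G v) (allFin n)

  neighbour≢v : ∀ {x} → Adj G v x → x ≢ v
  neighbour≢v Gvx = Adj⇒≢ G (Adj-sym G Gvx)

  H-avoids-v : ∀ {x y} → Adj H x y → y ≢ v
  H-avoids-v {x} Hxy refl = subst T (deleted x) (Adj-sym H Hxy)

  -- Besides the edge to v, every G-edge of a leaves N (no triangles) and so is kept in H.
  healDeg+deg≤1+deg : ∀ {a} → Adj G v a → healDeg a + deg G a ≤ 1 + deg H a
  healDeg+deg≤1+deg {a} Gva = begin
    healDeg a + deg G a
      ≡⟨ cong (healDeg a +_) (count-split (Adj? G a) (_≟ v) (allFin n)) ⟩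
    healDeg a + (count (Adj? G a ∩? (_≟ v)) (allFin n) + count (Adj? G a ∩? ∁? (_≟ v)) (allFin n))
      ≤⟨ +-monoʳ-≤ (healDeg a) (+-mono-≤ at-most-v
           (count-mono (Adj? G a ∩? ∁? (_≟ v)) (Adj? H a ∩? ∁? (Adj? G v)) kept (allFin n))) ⟩
    healDeg a + (1 + count (Adj? H a ∩? ∁? (Adj? G v)) (allFin n))
      ≡⟨ +-suc (healDeg a) _ ⟩
    1 + (healDeg a + count (Adj? H a ∩? ∁? (Adj? G v)) (allFin n))
      ≡⟨ cong suc (count-split (Adj? H a) (Adj? G v) (allFin n)) ⟨
    1 + deg H a ∎
    where
    open ≤-Reasoning
    at-most-v : count (Adj? G a ∩? (_≟ v)) (allFin n) ≤ 1
    at-most-v = ≤-trans (count-mono (Adj? G a ∩? (_≟ v)) (_≟ v) proj₂ (allFin n))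
                        (count-≡-unique _≟_ (allFin⁺ n))
    kept : ∀ {w} → Adj G a w × w ≢ v → Adj H a w × ¬ Adj G v w
    kept {w} (Gaw , w≢v) = keeps a w (neighbour≢v Gva) w≢v Gaw
                         , λ Gvw → triangle-free acyclic Gva Gaw (Adj-sym G Gvw)

  degree-increases : ∀ {a} → Adj G v a → 2 ≤ healDeg a → deg G a < deg H a
  degree-increases {a} Gva 2≤h =
    +-cancelˡ-≤ 1 _ _ (≤-trans (+-monoˡ-≤ (deg G a) 2≤h) (healDeg+deg≤1+deg Gva))

  healDeg-bounded : ∀ {M} → DegreeBounded M G v H → ∀ {a} → Adj G v a → healDeg a ≤ 1 + M
  healDeg-bounded {M} bounded {a} Gva = +-cancelʳ-≤ (deg G a) _ _ (begin
    healDeg a + deg G a ≤⟨ healDeg+deg≤1+deg Gva ⟩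
    1 + deg H a         ≤⟨ +-monoʳ-≤ 1 (bounded a (neighbour≢v Gva)) ⟩
    1 + (deg G a + M)   ≡⟨ cong suc (+-comm (deg G a) M) ⟩
    1 + M + deg G a     ∎)
    where open ≤-Reasoning

  unhealed-neighbour : ∀ {a} → 2 + healDeg a ≤ deg G v → ∃ λ b → (Adj G v b × ¬ Adj H a b) × b ≢ a
  unhealed-neighbour {a} room = count-witness-≢ _≟_ (Adj? G v ∩? ∁? (Adj? H a)) (allFin⁺ n) two a
    where
    open ≤-Reasoning
    two : 2 ≤ count (Adj? G v ∩? ∁? (Adj? H a)) (allFin n)
    two = +-cancelʳ-≤ (healDeg a) _ _ (begin
      2 + healDeg a ≤⟨ room ⟩
      deg G v       ≡⟨ count-split (Adj? G v) (Adj? H a) (allFin n) ⟩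
      count (Adj? G v ∩? Adj? H a) (allFin n) + count (Adj? G v ∩? ∁? (Adj? H a)) (allFin n)
        ≤⟨ +-monoˡ-≤ _ (count-mono (Adj? G v ∩? Adj? H a) (Adj? H a ∩? Adj? G v) swap (allFin n)) ⟩
      healDeg a + count (Adj? G v ∩? ∁? (Adj? H a)) (allFin n)
        ≡⟨ +-comm (healDeg a) _ ⟩
      count (Adj? G v ∩? ∁? (Adj? H a)) (allFin n) + healDeg a ∎)

  healDeg≤1⇒unique : ∀ {a} → healDeg a ≤ 1 → ∀ {y y'} → Adj G v y → Adj G v y' →
                     Adj H a y → Adj H a y' → y ≡ y'
  healDeg≤1⇒unique h≤1 {y} {y'} Gvy Gvy' Hay Hay' = decidable-stable (y ≟ y') λ y≢y' →
    n≮n 1 (≤-trans (count-two _≟_ (Adj? H _ ∩? Adj? G v) (∈-allFin y) (∈-allFin y') y≢y'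
                                (Hay , Gvy) (Hay' , Gvy')) h≤1)

  module _ {u} (Gvu : Adj G v u) (small : ∀ {x} → Adj G v x → Adj H u x → healDeg x ≤ 1) where

    -- The vertices reachable in G − v from u or from a healing neighbour of u; the
    -- hypothesis small makes this set closed under H-edges.
    private
      Star : Fin n → Set
      Star x = ∃ λ w → Adj G v w × (w ≡ u ⊎ Adj H u w) × ReachableWithout G v w x

      closed : ∀ {x y} → Star x → Adj H x y → Star y
      closed {x} {y} (w , Gvw , w-root , r) Hxy with local x y Hxy
      ... | inj₁ Gxy         = w , Gvw , w-root , extend r Gxy (H-avoids-v Hxy)
      ... | inj₂ (Gvx , Gvy) =
        y , Gvy , y-root (acyclic⇒separated acyclic Gvw Gvx r) w-root , start (neighbour≢v Gvy)
        where
        y-root : x ≡ w → w ≡ u ⊎ Adj H u w → y ≡ u ⊎ Adj H u y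
        y-root refl (inj₁ refl) = inj₂ Hxy
        y-root refl (inj₂ Hux)  = inj₁ (healDeg≤1⇒unique (small Gvx Hux) Gvy Gvu Hxy (Adj-sym H Hux))

    healing-star : ∀ {c} → Adj G v c → c ≡ u ⊎ Adj H u c
    healing-star {c} Gvc
      with Reachable-closed closed (u , Gvu , inj₁ refl , start (neighbour≢v Gvu))
                                   (connected u c (neighbour≢v Gvu) (neighbour≢v Gvc))
    ... | w , Gvw , w-root , r =
      subst (λ x → x ≡ u ⊎ Adj H u x) (sym (acyclic⇒separated acyclic Gvw Gvc r)) w-root

  Increases : Fin n → Set
  Increases a = Adj G v a × 2 ≤ healDeg a

  Increases? : Decidable Increases
  Increases? a = Adj? G v a ×-dec (2 ≤? healDeg a)

  other-increases : ∀ {M} → DegreeBounded M G v H → M + 3 ≤ deg G v →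
                    ∀ {c} → Adj G v c → ∃ λ a → Increases a × a ≢ c
  other-increases {M} bounded big {c} Gvc
    with unhealed-neighbour room | any? (λ a → Increases? a ×-dec ¬? (a ≟ c))
    where
    room : 2 + healDeg c ≤ deg G v
    room = ≤-trans (+-monoʳ-≤ 2 (healDeg-bounded bounded Gvc)) (≤-trans (≤-reflexive (+-comm 3 M)) big)
  ... | _                        | yes found = found
  ... | u , (Gvu , ¬Hcu) , u≢c | no none   =
    ⊥-elim ([ ≢-sym u≢c , ¬Hcu ∘ Adj-sym H ]′ (healing-star Gvu small Gvc))
    where
    small : ∀ {x} → Adj G v x → Adj H u x → healDeg x ≤ 1
    small {x} Gvx Hux = ≮⇒≥ λ 2≤h →
      none (x , (Gvx , 2≤h) , λ x≡c → ¬Hcu (Adj-sym H (subst (Adj H u) x≡c Hux)))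

lemma12 : (M n : ℕ) (G : Graph n) (v : Fin n) (H : Graph n) →
          IsTree G →
          LocalityAwareHealing G v H →
          DegreeBounded M G v H →
          M + 3 ≤ deg G v →
          Σ (Fin n) λ u₁ → Σ (Fin n) λ u₂ →
            u₁ ≢ u₂ × Adj G v u₁ × Adj G v u₂ ×
            deg G u₁ < deg H u₁ × deg G u₂ < deg H u₂
lemma12 M n G v H (_ , acyclic) heal bounded big =
  let c , Gvc               = some-neighbour
      a , (Gva , 2≤a) , _   = other-increases bounded big Gvc
      b , (Gvb , 2≤b) , b≢a = other-increases bounded big Gva
  in a , b , ≢-sym b≢a , Gva , Gvb , degree-increases Gva 2≤a , degree-increases Gvb 2≤b
  where
  open Healing acyclic heal
  some-neighbour : ∃ (Adj G v)
  some-neighbour = count-witness (Adj? G v) (allFin n) (≤-trans (s≤s z≤n) (≤-trans (m≤n+m 3 M) big))
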